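{- Let $\sigma$ be the substitution on $\{0,1\}$ with $\sigma(1)=1010$ and $\sigma(0)=0$, and let $\psi$ be the infinite binary word that is the limit of $\sigma^n(1)$ as $n\to\infty$ (so $\psi=1010010100010100101000\cdots$, each $\sigma^n(1)$ being a prefix of $\sigma^{n+1}(1)$). Then for any factor $\beta$ of $\psi$, the weights of the $\beta$-gap factors are bounded, and consequently $\psi\in\Gamma$.
   Context: A factor of a word is a contiguous subword; the weight of a finite word is its number of non-zero letters. An infinite word is recurrent if each of its factors occurs infinitely many times. For a factor $\beta$ of a recurrent word $\alpha$, the $\beta$-gap factors are the factors of $\alpha$ lying between consecutive occurrences of $\beta$. $\Gamma$ is the set of all recurrent infinite words over $\{0,1,2,3\}$, other than the all-zero word, such that for every factor $\beta$ the weights of the $\beta$-gap factors are bounded. -}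

module Defs where

open import Data.Nat using (ℕ; zero; suc; _+_; _∸_; _≤_; _<_)
open import Data.Fin using (Fin; zero; suc)
open import Data.List using (List; []; _∷_; length; concatMap)
open import Data.Product using (Σ; ∃; _×_)
open import Relation.Binary.PropositionalEquality using (_≡_)
open import Relation.Nullary using (¬_)

Letter : Set
Letter = Fin 4

InfWord : Set
InfWord = ℕ → Letter

weight : List Letter → ℕ
weight [] = 0
weight (zero ∷ w) = weight w
weight (suc _ ∷ w) = suc (weight w)

slice : InfWord → ℕ → ℕ → List Letter
slice α i zero = []
slice α i (suc n) = α i ∷ slice α (suc i) n

OccursAt : InfWord → List Letter → ℕ → Set
OccursAt α β i = slice α i (length β) ≡ β

IsFactor : InfWord → List Letter → Set
IsFactor α β = ∃ λ i → OccursAt α β i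

Recurrent : InfWord → Set
Recurrent α = ∀ β → IsFactor α β → ∀ N → ∃ λ i → N ≤ i × OccursAt α β i

ConsecutiveOcc : InfWord → List Letter → ℕ → ℕ → Set
ConsecutiveOcc α β i j =
  i < j × OccursAt α β i × OccursAt α β j ×
  (∀ k → i < k → k < j → ¬ OccursAt α β k)

-- The β-gap factor between consecutive occurrences at i and j: the factor
-- strictly between the end of the occurrence at i and the start of the one at j
-- (empty when the occurrences overlap or abut).
gapFactor : InfWord → List Letter → ℕ → ℕ → List Letter
gapFactor α β i j = slice α (i + length β) (j ∸ (i + length β))

BoundedGapWeights : InfWord → List Letter → Set
BoundedGapWeights α β =
  ∃ λ B → ∀ i j → ConsecutiveOcc α β i j → weight (gapFactor α β i j) ≤ B

InΓ : InfWord → Set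
InΓ α = Recurrent α × ¬ (∀ n → α n ≡ zero) × (∀ β → IsFactor α β → BoundedGapWeights α β)

-- The substitution σ : 1 ↦ 1010, 0 ↦ 0 (on words over {0,1,2,3}, with the
-- binary letters embedded; letters 2,3 never occur in ψ and are mapped to 0
-- only to make σ total).
σ₁ : Letter → List Letter
σ₁ (suc zero) = suc zero ∷ zero ∷ suc zero ∷ zero ∷ []
σ₁ _ = zero ∷ []

σ : List Letter → List Letter
σ = concatMap σ₁

σ^_[1] : ℕ → List Letter
σ^ zero [1] = suc zero ∷ []
σ^ suc n [1] = σ (σ^ n [1])

nth : List Letter → ℕ → Letter
nth [] _ = zero
nth (x ∷ w) zero = x
nth (x ∷ w) (suc n) = nth w n

-- ψ = lim σⁿ(1): its n-th letter is the n-th letter of σ^(n+1)(1),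
-- which has length > n (and σᵏ(1) is a prefix of σᵏ⁺¹(1)).
ψ : InfWord
ψ n = nth (σ^ suc n [1]) n

-- Write vₘ = σᵐ(1), ℓₘ = |vₘ| and pₘ = ℓₘ + 1. Since vₘ₊₁ = vₘ0vₘ0, the prefix
-- of ψ of length 2pₘ has period pₘ, and ψ(ℓₘ) = 0. By induction on m ≥ n, from
-- every position i ≤ pₘ one reaches, through a factor of weight at most pₙ,
-- either the position pₘ or an occurrence of vₙ ending before pₘ; as pₘ itself
-- starts an occurrence of vₙ, every position of ψ is followed by an occurrence
-- of vₙ at weight distance at most pₙ. Every factor β lies in some prefix vₙ,
-- so the same holds for β, which gives recurrence and bounded gap weights.
module Submission where

open import Defs
open import Data.Fin using (zero; suc)
open import Data.List using (List; []; _∷_; _++_; length)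
open import Data.List.Properties using (concatMap-++; length-++)
open import Data.Nat using (ℕ; zero; suc; _+_; _∸_; _≤_; _<_; z≤n; s≤s; s≤s⁻¹; _≤?_)
open import Data.Nat.Properties
open import Data.Product using (∃; _×_; _,_)
open import Data.Sum using (_⊎_; inj₁; inj₂)
open import Relation.Nullary using (¬_; yes; no)
open import Relation.Binary.PropositionalEquality

≤-+-split : ∀ a b {i} → i ≤ a + b → i ≤ a ⊎ ∃ λ i′ → i′ ≤ b × i ≡ a + i′
≤-+-split a b {i} i≤a+b with i ≤? a
... | yes i≤a = inj₁ i≤a
... | no i≰a = inj₂ (i ∸ a , m≤n+o⇒m∸n≤o i a i≤a+b , sym (m+[n∸m]≡n (<⇒≤ (≰⇒> i≰a))))

weight-++ : ∀ xs ys → weight (xs ++ ys) ≡ weight xs + weight ys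
weight-++ [] ys = refl
weight-++ (zero ∷ xs) ys = weight-++ xs ys
weight-++ (suc _ ∷ xs) ys = cong suc (weight-++ xs ys)

weight-∷-≤ : ∀ x xs → weight (x ∷ xs) ≤ suc (weight xs)
weight-∷-≤ zero xs = n≤1+n (weight xs)
weight-∷-≤ (suc _) xs = ≤-refl

slice-++ : ∀ (α : InfWord) a x z → slice α a (x + z) ≡ slice α a x ++ slice α (a + x) z
slice-++ α a zero z = cong (λ k → slice α k z) (sym (+-identityʳ a))
slice-++ α a (suc x) z = cong (α a ∷_) (begin
  slice α (suc a) (x + z)                  ≡⟨ slice-++ α (suc a) x z ⟩
  slice α (suc a) x ++ slice α (suc a + x) z ≡⟨ cong (λ k → slice α (suc a) x ++ slice α k z) (sym (+-suc a x)) ⟩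
  slice α (suc a) x ++ slice α (a + suc x) z ∎)
  where open ≡-Reasoning

slice-cong : ∀ (α : InfWord) a b l → (∀ t → t < l → α (a + t) ≡ α (b + t)) →
             slice α a l ≡ slice α b l
slice-cong α a b zero eq = refl
slice-cong α a b (suc l) eq = cong₂ _∷_ head (slice-cong α (suc a) (suc b) l tail)
  where
  head : α a ≡ α b
  head = subst₂ (λ x y → α x ≡ α y) (+-identityʳ a) (+-identityʳ b) (eq 0 (s≤s z≤n))
  tail : ∀ t → t < l → α (suc a + t) ≡ α (suc b + t)
  tail t t<l = subst₂ (λ x y → α x ≡ α y) (+-suc a t) (+-suc b t) (eq (suc t) (s≤s t<l))

weight-slice-≤ : ∀ (α : InfWord) a l → weight (slice α a l) ≤ l
weight-slice-≤ α a zero = z≤n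
weight-slice-≤ α a (suc l) = ≤-trans (weight-∷-≤ (α a) _) (s≤s (weight-slice-≤ α (suc a) l))

weight-slice-mono : ∀ (α : InfWord) a {l l′} → l ≤ l′ → weight (slice α a l) ≤ weight (slice α a l′)
weight-slice-mono α a z≤n = z≤n
weight-slice-mono α a (s≤s l≤l′) with α a
... | zero = weight-slice-mono α (suc a) l≤l′
... | suc _ = s≤s (weight-slice-mono α (suc a) l≤l′)

nth-++ˡ : ∀ xs ys {t} → t < length xs → nth (xs ++ ys) t ≡ nth xs t
nth-++ˡ (x ∷ xs) ys {zero} _ = refl
nth-++ˡ (x ∷ xs) ys {suc t} (s≤s t<n) = nth-++ˡ xs ys t<n

nth-++ʳ : ∀ xs ys k → nth (xs ++ ys) (length xs + k) ≡ nth ys k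
nth-++ʳ [] ys k = refl
nth-++ʳ (x ∷ xs) ys k = nth-++ʳ xs ys k

nth-length : ∀ xs y ys → nth (xs ++ y ∷ ys) (length xs) ≡ y
nth-length [] y ys = refl
nth-length (x ∷ xs) y ys = nth-length xs y ys

v : ℕ → List Letter
v m = σ^ m [1]

v0 : ℕ → List Letter
v0 m = v m ++ zero ∷ []

ℓ : ℕ → ℕ
ℓ m = length (v m)

period : ℕ → ℕ
period m = suc (ℓ m)

length-v0 : ∀ m → length (v0 m) ≡ period m
length-v0 m = trans (length-++ (v m)) (+-comm (ℓ m) 1)

σ-v0 : ∀ m → σ (v0 m) ≡ v0 (suc m)
σ-v0 m = concatMap-++ σ₁ (v m) (zero ∷ [])

v-suc : ∀ m → v (suc m) ≡ v0 m ++ v0 m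
v-suc zero = refl
v-suc (suc m) = begin
  σ (v (suc m))        ≡⟨ cong σ (v-suc m) ⟩
  σ (v0 m ++ v0 m)     ≡⟨ concatMap-++ σ₁ (v0 m) (v0 m) ⟩
  σ (v0 m) ++ σ (v0 m) ≡⟨ cong₂ _++_ (σ-v0 m) (σ-v0 m) ⟩
  v0 (suc m) ++ v0 (suc m) ∎
  where open ≡-Reasoning

ℓ-suc : ∀ m → ℓ (suc m) ≡ period m + period m
ℓ-suc m = begin
  length (v (suc m))            ≡⟨ cong length (v-suc m) ⟩
  length (v0 m ++ v0 m)         ≡⟨ length-++ (v0 m) ⟩
  length (v0 m) + length (v0 m) ≡⟨ cong₂ _+_ (length-v0 m) (length-v0 m) ⟩
  period m + period m           ∎
  where open ≡-Reasoning

period+period≤ℓ : ∀ m → period m + period m ≤ ℓ (suc m)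
period+period≤ℓ m = ≤-reflexive (sym (ℓ-suc m))

period≤ℓ : ∀ m → period m ≤ ℓ (suc m)
period≤ℓ m = ≤-trans (m≤m+n (period m) (period m)) (period+period≤ℓ m)

period≤period-suc : ∀ m → period m ≤ period (suc m)
period≤period-suc m = m≤n⇒m≤1+n (period≤ℓ m)

ℓ-mono : ∀ k m → ℓ m ≤ ℓ (k + m)
ℓ-mono zero m = ≤-refl
ℓ-mono (suc k) m = ≤-trans (ℓ-mono k m) (<⇒≤ (period≤ℓ (k + m)))

n<ℓ : ∀ n → n < ℓ n
n<ℓ zero = s≤s z≤n
n<ℓ (suc n) = ≤-trans (s≤s (n<ℓ n)) (period≤ℓ n)

nth-v-suc : ∀ m {t} → t < ℓ m → nth (v (suc m)) t ≡ nth (v m) t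
nth-v-suc m {t} t<ℓ = begin
  nth (v (suc m)) t    ≡⟨ cong (λ w → nth w t) (v-suc m) ⟩
  nth (v0 m ++ v0 m) t ≡⟨ nth-++ˡ (v0 m) (v0 m) (subst (t <_) (sym (length-v0 m)) (m≤n⇒m≤1+n t<ℓ)) ⟩
  nth (v0 m) t         ≡⟨ nth-++ˡ (v m) (zero ∷ []) t<ℓ ⟩
  nth (v m) t ∎
  where open ≡-Reasoning

nth-v-stable : ∀ k m {t} → t < ℓ m → nth (v (k + m)) t ≡ nth (v m) t
nth-v-stable zero m t<ℓ = refl
nth-v-stable (suc k) m t<ℓ =
  trans (nth-v-suc (k + m) (≤-trans t<ℓ (ℓ-mono k m))) (nth-v-stable k m t<ℓ)

ψ-nth : ∀ m {t} → t < ℓ m → ψ t ≡ nth (v m) t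
ψ-nth m {t} t<ℓ = begin
  nth (v (suc t)) t     ≡⟨ sym (nth-v-stable m (suc t) (<-trans (n<1+n t) (n<ℓ (suc t)))) ⟩
  nth (v (m + suc t)) t ≡⟨ cong (λ k → nth (v k) t) (+-comm m (suc t)) ⟩
  nth (v (suc t + m)) t ≡⟨ nth-v-stable (suc t) m t<ℓ ⟩
  nth (v m) t ∎
  where open ≡-Reasoning

ψ-nth-suc : ∀ m {t} → t < ℓ (suc m) → ψ t ≡ nth (v0 m ++ v0 m) t
ψ-nth-suc m {t} t<ℓ = trans (ψ-nth (suc m) t<ℓ) (cong (λ w → nth w t) (v-suc m))

ψ-ℓ : ∀ m → ψ (ℓ m) ≡ zero
ψ-ℓ m = begin
  ψ (ℓ m)                    ≡⟨ ψ-nth-suc m (period≤ℓ m) ⟩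
  nth (v0 m ++ v0 m) (ℓ m)   ≡⟨ nth-++ˡ (v0 m) (v0 m) (≤-reflexive (sym (length-v0 m))) ⟩
  nth (v0 m) (ℓ m)           ≡⟨ nth-length (v m) zero [] ⟩
  zero ∎
  where open ≡-Reasoning

ψ-period : ∀ m {t} → t < period m → ψ (period m + t) ≡ ψ t
ψ-period m {t} t<p = begin
  ψ (period m + t)                          ≡⟨ ψ-nth-suc m (≤-trans (+-monoʳ-< (period m) t<p) (period+period≤ℓ m)) ⟩
  nth (v0 m ++ v0 m) (period m + t)         ≡⟨ cong (λ k → nth (v0 m ++ v0 m) (k + t)) (sym (length-v0 m)) ⟩
  nth (v0 m ++ v0 m) (length (v0 m) + t)    ≡⟨ nth-++ʳ (v0 m) (v0 m) t ⟩
  nth (v0 m) t                              ≡⟨ sym (nth-++ˡ (v0 m) (v0 m) (subst (t <_) (sym (length-v0 m)) t<p)) ⟩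
  nth (v0 m ++ v0 m) t                      ≡⟨ sym (ψ-nth-suc m (≤-trans t<p (period≤ℓ m))) ⟩
  ψ t ∎
  where open ≡-Reasoning

weightψ : ℕ → ℕ → ℕ
weightψ a l = weight (slice ψ a l)

weightψ-++ : ∀ a x z → weightψ a (x + z) ≡ weightψ a x + weightψ (a + x) z
weightψ-++ a x z = trans (cong weight (slice-++ ψ a x z)) (weight-++ (slice ψ a x) _)

weightψ-zero : ∀ a → ψ a ≡ zero → weightψ a 1 ≡ 0
weightψ-zero a ψa≡0 rewrite ψa≡0 = refl

weightψ-period : ∀ m a l → a + l ≤ period m → weightψ (period m + a) l ≡ weightψ a l
weightψ-period m a l a+l≤p = cong weight (slice-cong ψ (period m + a) a l shifted)
  where
  shifted : ∀ t → t < l → ψ (period m + a + t) ≡ ψ (a + t)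
  shifted t t<l = trans (cong ψ (+-assoc (period m) a t)) (ψ-period m (≤-trans (+-monoʳ-< a t<l) a+l≤p))

BlockAt : ℕ → ℕ → Set
BlockAt n q = ∀ t → t < ℓ n → ψ (q + t) ≡ ψ t

BlockAt-period : ∀ n m → ℓ n ≤ ℓ m → BlockAt n (period m)
BlockAt-period n m ℓn≤ℓm t t<ℓn = ψ-period m (≤-trans t<ℓn (m≤n⇒m≤1+n ℓn≤ℓm))

BlockAt-shift : ∀ n m q → q + ℓ n ≤ period m → BlockAt n q → BlockAt n (period m + q)
BlockAt-shift n m q q+ℓ≤p block t t<ℓ = begin
  ψ (period m + q + t)   ≡⟨ cong ψ (+-assoc (period m) q t) ⟩
  ψ (period m + (q + t)) ≡⟨ ψ-period m (≤-trans (+-monoʳ-< q t<ℓ) q+ℓ≤p) ⟩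
  ψ (q + t)              ≡⟨ block t t<ℓ ⟩
  ψ t ∎
  where open ≡-Reasoning

OccursAt-block : ∀ n {β o} q → o + length β ≤ ℓ n → OccursAt ψ β o → BlockAt n q →
                 OccursAt ψ β (q + o)
OccursAt-block n {β} {o} q o+b≤ℓ occ block = trans (slice-cong ψ (q + o) o (length β) copy) occ
  where
  copy : ∀ t → t < length β → ψ (q + o + t) ≡ ψ (o + t)
  copy t t<b = trans (cong ψ (+-assoc q o t)) (block (o + t) (≤-trans (+-monoʳ-< o t<b) o+b≤ℓ))

BlockWithin : ℕ → ℕ → ℕ → Set
BlockWithin n m q = q + ℓ n ≤ period m × BlockAt n q

BlockOrEnd : ℕ → ℕ → ℕ → Set
BlockOrEnd n m q = q ≡ period m ⊎ BlockWithin n m q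

BlockAhead : ℕ → ℕ → ℕ → ℕ → Set
BlockAhead n m i d = weightψ i d ≤ period n × BlockOrEnd n m (i + d)

BlockOrEnd-suc : ∀ n m {q} → ℓ n ≤ ℓ m → BlockOrEnd n m q → BlockOrEnd n (suc m) q
BlockOrEnd-suc n m ℓn≤ℓm (inj₁ refl) = inj₂ (bound , BlockAt-period n m ℓn≤ℓm)
  where
  bound : period m + ℓ n ≤ period (suc m)
  bound = ≤-trans (+-monoʳ-≤ (period m) (m≤n⇒m≤1+n ℓn≤ℓm)) (m≤n⇒m≤1+n (period+period≤ℓ m))
BlockOrEnd-suc n m _ (inj₂ (bound , block)) = inj₂ (≤-trans bound (period≤period-suc m) , block)

-- On the second copy of vₘ0 in vₘ₊₁ the landing position shifts by pₘ; the end
-- pₘ shifts to ℓₘ₊₁, where ψ is 0, so one more step reaches pₘ₊₁.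
BlockAhead-shift : ∀ n m {i} → ∃ (BlockAhead n m i) → ∃ (BlockAhead n (suc m) (period m + i))
BlockAhead-shift n m {i} (d , w≤ , inj₂ (bound , block)) = d , w≤′ , inj₂ (bound′ , block′)
  where
  p = period m
  w≤′ : weightψ (p + i) d ≤ period n
  w≤′ = subst (_≤ period n) (sym (weightψ-period m i d (≤-trans (m≤m+n (i + d) (ℓ n)) bound))) w≤
  bound′ : p + i + d + ℓ n ≤ period (suc m)
  bound′ = subst (_≤ period (suc m)) (sym reassoc)
             (≤-trans (+-monoʳ-≤ p bound) (m≤n⇒m≤1+n (period+period≤ℓ m)))
    where
    reassoc : p + i + d + ℓ n ≡ p + (i + d + ℓ n)
    reassoc = trans (cong (_+ ℓ n) (+-assoc p i d)) (+-assoc p (i + d) (ℓ n))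
  block′ : BlockAt n (p + i + d)
  block′ = subst (BlockAt n) (sym (+-assoc p i d)) (BlockAt-shift n m (i + d) bound block)
BlockAhead-shift n m {i} (d , w≤ , inj₁ i+d≡p) = d + 1 , w≤′ , inj₁ end
  where
  p = period m
  p+i+d≡ℓ : p + i + d ≡ ℓ (suc m)
  p+i+d≡ℓ = trans (+-assoc p i d) (trans (cong (p +_) i+d≡p) (sym (ℓ-suc m)))
  same-weight : weightψ (p + i) (d + 1) ≡ weightψ i d
  same-weight = begin
    weightψ (p + i) (d + 1)                   ≡⟨ weightψ-++ (p + i) d 1 ⟩
    weightψ (p + i) d + weightψ (p + i + d) 1 ≡⟨ cong₂ _+_ (weightψ-period m i d (≤-reflexive i+d≡p))
                                                   (weightψ-zero (p + i + d) (trans (cong ψ p+i+d≡ℓ) (ψ-ℓ (suc m)))) ⟩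
    weightψ i d + 0                           ≡⟨ +-identityʳ _ ⟩
    weightψ i d ∎
    where open ≡-Reasoning
  w≤′ : weightψ (p + i) (d + 1) ≤ period n
  w≤′ = subst (_≤ period n) (sym same-weight) w≤
  end : p + i + (d + 1) ≡ period (suc m)
  end = trans (sym (+-assoc (p + i) d 1)) (trans (cong (_+ 1) p+i+d≡ℓ) (+-comm _ 1))

BlockAhead-end : ∀ n m → BlockAhead n m (period m) 0
BlockAhead-end n m = z≤n , inj₁ (+-identityʳ (period m))

BlockAhead-base : ∀ n {i} → i ≤ period n → ∃ (BlockAhead n n i)
BlockAhead-base n {i} i≤p =
  period n ∸ i , ≤-trans (weight-slice-≤ ψ i _) (m∸n≤m (period n) i) , inj₁ (m+[n∸m]≡n i≤p)

BlockAhead-suc : ∀ n m → ℓ n ≤ ℓ m → (∀ i → i ≤ period m → ∃ (BlockAhead n m i)) →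
                 ∀ i → i ≤ period (suc m) → ∃ (BlockAhead n (suc m) i)
BlockAhead-suc n m ℓn≤ℓm ahead i i≤ with m≤n⇒m<n∨m≡n i≤
... | inj₂ refl = 0 , BlockAhead-end n (suc m)
... | inj₁ i<p with ≤-+-split (period m) (period m) (subst (i ≤_) (ℓ-suc m) (s≤s⁻¹ i<p))
...   | inj₂ (i′ , i′≤p , refl) = BlockAhead-shift n m (ahead i′ i′≤p)
...   | inj₁ i≤p with ahead i i≤p
...     | d , w≤ , landing = d , w≤ , BlockOrEnd-suc n m ℓn≤ℓm landing

BlockAhead-within : ∀ k n i → i ≤ period (k + n) → ∃ (BlockAhead n (k + n) i)
BlockAhead-within zero n i = BlockAhead-base n
BlockAhead-within (suc k) n = BlockAhead-suc n (k + n) (ℓ-mono k n) (BlockAhead-within k n)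

block-ahead : ∀ n i → ∃ λ d → weightψ i d ≤ period n × BlockAt n (i + d)
block-ahead n i with BlockAhead-within i n i (≤-trans (m≤m+n i n) (<⇒≤ (m<n⇒m<1+n (n<ℓ (i + n)))))
... | d , w≤ , inj₁ i+d≡p = d , w≤ , subst (BlockAt n) (sym i+d≡p) (BlockAt-period n (i + n) (ℓ-mono i n))
... | d , w≤ , inj₂ (_ , block) = d , w≤ , block

occurrence-ahead : ∀ {β o} → OccursAt ψ β o → ∀ i →
                   ∃ λ d → weightψ i d ≤ period (o + length β) × OccursAt ψ β (i + d + o)
occurrence-ahead {β} {o} occ i with block-ahead (o + length β) i
... | d , w≤ , block = d , w≤ , OccursAt-block (o + length β) (i + d) (<⇒≤ (n<ℓ (o + length β))) occ block

ψ-recurrent : Recurrent ψ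
ψ-recurrent β (o , occ) N with occurrence-ahead occ N
... | d , _ , occ′ = N + d + o , ≤-trans (m≤m+n N d) (m≤m+n (N + d) o) , occ′

gap-weights-bounded : ∀ β → IsFactor ψ β → BoundedGapWeights ψ β
gap-weights-bounded β (o , occ) = suc (period (o + length β) + o) , gap-bound
  where
  gap-bound : ∀ i j → ConsecutiveOcc ψ β i j → weight (gapFactor ψ β i j) ≤ suc (period (o + length β) + o)
  -- Searching from i + |β| + 1 keeps the next occurrence beyond i even when β is empty.
  gap-bound i j (_ , _ , _ , none) with occurrence-ahead occ (suc (i + length β))
  ... | d , w≤ , occ′ = begin
    weightψ s (j ∸ s)                               ≤⟨ weight-slice-mono ψ s gap≤ ⟩
    weightψ s (suc (d + o))                         ≤⟨ weight-∷-≤ (ψ s) _ ⟩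
    suc (weightψ (suc s) (d + o))                   ≡⟨ cong suc (weightψ-++ (suc s) d o) ⟩
    suc (weightψ (suc s) d + weightψ (suc s + d) o) ≤⟨ s≤s (+-mono-≤ w≤ (weight-slice-≤ ψ _ o)) ⟩
    suc (period (o + length β) + o)                 ∎
    where
    open ≤-Reasoning
    s = i + length β
    i<next : i < suc s + d + o
    i<next = ≤-trans (s≤s (m≤m+n i (length β))) (≤-trans (m≤m+n (suc s) d) (m≤m+n (suc s + d) o))
    j≤next : j ≤ suc s + d + o
    j≤next = ≮⇒≥ (λ next<j → none (suc s + d + o) i<next next<j occ′)
    gap≤ : j ∸ s ≤ suc (d + o)
    gap≤ = m≤n+o⇒m∸n≤o j s (subst (j ≤_) (trans (+-assoc (suc s) d o) (sym (+-suc s (d + o)))) j≤next)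

ψ-nonzero : ¬ (∀ n → ψ n ≡ zero)
ψ-nonzero allZero with allZero 0
... | ()

lemma5p2 : (∀ β → IsFactor ψ β → BoundedGapWeights ψ β) × InΓ ψ
lemma5p2 = gap-weights-bounded , ψ-recurrent , ψ-nonzero , gap-weights-bounded
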